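{- Let $a \ge 3$ and $n \ge a$ be integers. Define $t_a^a = \binom{a}{2} - 1$ and $t_a^{i+1} = \left\lfloor \frac{i+1}{i-1}\, t_a^i \right\rfloor$ for $i \ge a$. Then $$ex(n,a,2) = t_a^n = \left\lfloor \frac{n}{n-2} \left \lfloor \frac{n-1}{n-3} \left \lfloor \cdots \left \lfloor \frac{a+2}{a} \left \lfloor \frac{a+1}{a-1} \cdot \left(\binom{a}{2} -1\right) \right \rfloor \right \rfloor \cdots \right \rfloor \right \rfloor \right \rfloor,$$ i.e., the maximum number of edges of a graph on $n$ vertices containing no clique on $a$ vertices equals $t_a^n$.
   Context: For integers $n\ge 1$, $a \ge 2$, $ex(n,a,2)$ denotes the maximum number of edges in a simple graph on vertex set $[n]=\{1,\dots,n\}$ that contains no complete subgraph $K_a$ on $a$ vertices; equivalently, it is $\max\{\sum_e x_e : x \in T(n,a,2)\}$, where $T(n,a,2)\subseteq \mathbb{R}^{E(K_n)}$ is the convex hull of the characteristic vectors of all edge sets $F \subseteq E(K_n)$ containing no $a$-clique. -}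

module Defs where

open import Data.Nat using (ℕ; zero; suc; _+_; _*_; _∸_; _/_; _<?_)
open import Data.Nat.Combinatorics using (_C_)
open import Data.Fin using (Fin; toℕ)
open import Data.Fin.Properties using (all?)
open import Data.Bool using (Bool; true; false; _∧_)
open import Data.List using (List; length; filter; cartesianProduct; allFin)
open import Data.Product using (_×_; _,_; Σ; ∃)
open import Relation.Binary.PropositionalEquality using (_≡_; _≢_)
open import Relation.Nullary using (¬_; Dec; yes; no)
open import Relation.Nullary.Decidable using (⌊_⌋)
open import Function.Definitions using (Injective)

record Graph (n : ℕ) : Set where
  field
    adj   : Fin n → Fin n → Bool
    sym   : ∀ i j → adj i j ≡ adj j i
    irrefl : ∀ i → adj i i ≡ false
open Graph public

edgeCount : ∀ {n} → Graph n → ℕ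
edgeCount {n} G =
  length (filter (λ p → isEdge (Data.Product.proj₁ p) (Data.Product.proj₂ p) Data.Bool.≟ true)
                 (cartesianProduct (allFin n) (allFin n)))
  where
  isEdge : Fin n → Fin n → Bool
  isEdge i j = ⌊ toℕ i <? toℕ j ⌋ ∧ adj G i j

HasClique : ∀ {n} → ℕ → Graph n → Set
HasClique {n} a G =
  Σ (Fin a → Fin n) λ f →
    Injective _≡_ _≡_ f × (∀ i j → i ≢ j → adj G (f i) (f j) ≡ true)

CliqueFree : ∀ {n} → ℕ → Graph n → Set
CliqueFree a G = ¬ HasClique a G

IsEx : ℕ → ℕ → ℕ → Set
IsEx n a m =
  (Σ (Graph n) λ G → CliqueFree a G × edgeCount G ≡ m) ×
  (∀ (G : Graph n) → CliqueFree a G → edgeCount G Data.Nat.≤ m)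

-- tSeq a k = t_a^{a+k}.
-- t_a^a = C(a,2) - 1 ;  t_a^{i+1} = floor ((i+1) t_a^i / (i-1)) for i = a + k.
-- The divisor i - 1 = a + k - 1 is written suc (a + k ∸ 2), which equals
-- a + k - 1 whenever a ≥ 2 (in particular under the hypothesis a ≥ 3).
tSeq : ℕ → ℕ → ℕ
tSeq a zero    = (a C 2) ∸ 1
tSeq a (suc k) = ((suc (a + k)) * tSeq a k) / suc (a + k ∸ 2)

-- t_a^n (meaningful for n ≥ a)
t : ℕ → ℕ → ℕ
t a n = tSeq a (n ∸ a)

-- Write a = r + 1. Deleting a vertex v loses its deg v edges, so Σ_v e(G − v) = (n − 2) e(G)
-- (Katona–Nemetz–Simonovits); hence if every G − v has at most t^{n−1} edges, then
-- e(G) ≤ ⌊n t^{n−1} / (n − 2)⌋ = t^n, and the induction starts because a K_a-free graph on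
-- a vertices misses an edge. Conversely, colouring vertex i by i mod r gives the Turán graph,
-- K_a-free by pigeonhole. For n = q r + s twice its edge count is n² minus the sum of the
-- squared class sizes, and this yields ⌊(n + 1) e / (n − 1)⌋ = e + (n − q), which is exactly
-- the number of edges gained by adding the next vertex. Nothing needs a ≥ 3: a ≥ 2 suffices.
module Submission where

import Algebra.Properties.CommutativeMonoid.Sum
open import Data.Bool using (Bool; true; false; not; _∧_)
import Data.Bool as Bool
open import Data.Bool.Properties using (¬-not; T-≡)
open import Data.Empty using (⊥-elim)
open import Data.Fin using (Fin; toℕ; punchIn; punchOut; fromℕ; fromℕ<)
import Data.Fin.Properties as Finₚ
open import Data.List using (List; length; filter; cartesianProduct; allFin; tabulate; map; _++_)
import Data.List.Properties as Listₚ
open import Data.Nat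
open import Data.Nat.Properties
open import Data.Nat.DivMod
open import Data.Nat.Divisibility using (divides-refl)
open import Data.Nat.Combinatorics using (_C_; nCk+nC[k+1]≡[n+1]C[k+1]; nC1≡n)
open import Data.Nat.Tactic.RingSolver using (solve-∀)
open import Data.Product using (_×_; _,_; ∃₂)
open import Data.Sum using (_⊎_; inj₁; inj₂; [_,_])
open import Function using (_∘_; id)
open import Function.Bundles using (module Equivalence)
open import Relation.Binary.PropositionalEquality
  using (_≡_; _≢_; refl; sym; trans; cong; cong₂; subst; module ≡-Reasoning)
open import Relation.Nullary using (¬_; Dec; yes; no; does; _⊎-dec_)
open import Relation.Nullary.Decidable using (⌊_⌋)
open import Relation.Unary using (Pred; Decidable)

open import Defs hiding (sym; irrefl)

open Algebra.Properties.CommutativeMonoid.Sum +-0-commutativeMonoid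
  using (sum; sum-syntax; sum-cong-≗; sum-remove; sum-init-last; ∑-distrib-+; ∑-comm)

-- Finite sums and indicators

∑-mono-≤ : ∀ n {f g : Fin n → ℕ} → (∀ i → f i ≤ g i) → ∑[ i < n ] f i ≤ ∑[ i < n ] g i
∑-mono-≤ zero    f≤g = z≤n
∑-mono-≤ (suc n) f≤g = +-mono-≤ (f≤g Fin.zero) (∑-mono-≤ n (f≤g ∘ Fin.suc))

∑-const : ∀ n c → ∑[ i < n ] c ≡ n * c
∑-const zero    c = refl
∑-const (suc n) c = cong (c +_) (∑-const n c)

∑-toℕ-last : ∀ m (f : ℕ → ℕ) → ∑[ j < suc m ] f (toℕ j) ≡ ∑[ j < m ] f (toℕ j) + f m
∑-toℕ-last m f = trans (sum-init-last {m} (f ∘ toℕ))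
  (cong₂ _+_ (sum-cong-≗ {m} (cong f ∘ Finₚ.toℕ-inject₁)) (cong f (Finₚ.toℕ-fromℕ m)))

𝟙 : Bool → ℕ
𝟙 true  = 1
𝟙 false = 0

𝟙≤1 : ∀ b → 𝟙 b ≤ 1
𝟙≤1 true  = s≤s z≤n
𝟙≤1 false = z≤n

𝟙-not : ∀ b → 𝟙 (not b) + 𝟙 b ≡ 1
𝟙-not true  = refl
𝟙-not false = refl

∑𝟙≤ : ∀ n (p : Fin n → Bool) → ∑[ i < n ] 𝟙 (p i) ≤ n
∑𝟙≤ n p = ≤-trans (∑-mono-≤ n (𝟙≤1 ∘ p)) (≤-reflexive (trans (∑-const n 1) (*-identityʳ n)))

length-filter-tabulate : ∀ {a p} {A : Set a} {P : Pred A p} (P? : Decidable P) n (f : Fin n → A) →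
  length (filter P? (tabulate f)) ≡ ∑[ i < n ] 𝟙 (does (P? (f i)))
length-filter-tabulate P? zero    f = refl
length-filter-tabulate P? (suc n) f with does (P? (f Fin.zero))
... | true  = cong suc (length-filter-tabulate P? n (f ∘ Fin.suc))
... | false = length-filter-tabulate P? n (f ∘ Fin.suc)

length-filter-cartesianProduct : ∀ {n p} {P : Pred (Fin n × Fin n) p} (P? : Decidable P) m (f : Fin m → Fin n) →
  length (filter P? (cartesianProduct (tabulate f) (allFin n))) ≡
  ∑[ i < m ] ∑[ j < n ] 𝟙 (does (P? (f i , j)))
length-filter-cartesianProduct             P? zero    f = refl
length-filter-cartesianProduct {n = n} P? (suc m) f = begin
  length (filter P? (map (f Fin.zero ,_) (allFin n) ++ rest))
    ≡⟨ cong length (Listₚ.filter-++ P? (map (f Fin.zero ,_) (allFin n)) rest) ⟩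
  length (filter P? (map (f Fin.zero ,_) (allFin n)) ++ filter P? rest)
    ≡⟨ Listₚ.length-++ (filter P? (map (f Fin.zero ,_) (allFin n))) ⟩
  length (filter P? (map (f Fin.zero ,_) (allFin n))) + length (filter P? rest)
    ≡⟨ cong₂ _+_ (trans (cong (length ∘ filter P?) (Listₚ.map-tabulate id (f Fin.zero ,_)))
                        (length-filter-tabulate P? n (f Fin.zero ,_)))
                 (length-filter-cartesianProduct P? m (f ∘ Fin.suc)) ⟩
  ∑[ i < suc m ] ∑[ j < n ] 𝟙 (does (P? (f i , j))) ∎
  where
  open ≡-Reasoning
  rest : List (Fin _ × Fin n)
  rest = cartesianProduct (tabulate (f ∘ Fin.suc)) (allFin n)

-- Counting edges

isEdge : ∀ {n} → Graph n → Fin n → Fin n → Bool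
isEdge G i j = ⌊ toℕ i <? toℕ j ⌋ ∧ adj G i j

edgeCount≡∑isEdge : ∀ {n} (G : Graph n) → edgeCount G ≡ ∑[ i < n ] ∑[ j < n ] 𝟙 (isEdge G i j)
edgeCount≡∑isEdge {n} G = trans (length-filter-cartesianProduct _ n id)
  (sum-cong-≗ {n} λ i → sum-cong-≗ {n} λ j → 𝟙-≟true (isEdge G i j))
  where
  𝟙-≟true : ∀ b → 𝟙 (does (b Bool.≟ true)) ≡ 𝟙 b
  𝟙-≟true true  = refl
  𝟙-≟true false = refl

edgeCount-cong : ∀ {n} {G H : Graph n} → (∀ i j → adj G i j ≡ adj H i j) → edgeCount G ≡ edgeCount H
edgeCount-cong {n} {G} {H} G≗H = begin
  edgeCount G                              ≡⟨ edgeCount≡∑isEdge G ⟩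
  ∑[ i < n ] ∑[ j < n ] 𝟙 (isEdge G i j)  ≡⟨ sum-cong-≗ {n} (λ i → sum-cong-≗ {n} λ j →
                                                cong (λ b → 𝟙 (⌊ toℕ i <? toℕ j ⌋ ∧ b)) (G≗H i j)) ⟩
  ∑[ i < n ] ∑[ j < n ] 𝟙 (isEdge H i j)  ≡⟨ edgeCount≡∑isEdge H ⟨
  edgeCount H                              ∎
  where open ≡-Reasoning

degree : ∀ {n} → Graph n → Fin n → ℕ
degree {n} G v = ∑[ j < n ] 𝟙 (adj G v j)

degreeSum : ∀ {n} → Graph n → ℕ
degreeSum {n} G = ∑[ v < n ] degree G v

𝟙-adj≡isEdge+isEdge : ∀ {n} (G : Graph n) i j → 𝟙 (adj G i j) ≡ 𝟙 (isEdge G i j) + 𝟙 (isEdge G j i)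
𝟙-adj≡isEdge+isEdge G i j with toℕ i <? toℕ j | toℕ j <? toℕ i
... | yes i<j | yes j<i = ⊥-elim (<-asym i<j j<i)
... | yes _   | no  _   = sym (+-identityʳ _)
... | no  _   | yes _   = cong 𝟙 (Graph.sym G i j)
... | no  i≮j | no  j≮i with Finₚ.toℕ-injective (≤-antisym (≮⇒≥ j≮i) (≮⇒≥ i≮j))
...   | refl rewrite Graph.irrefl G i = refl

handshake : ∀ {n} (G : Graph n) → degreeSum G ≡ 2 * edgeCount G
handshake {n} G = begin
  degreeSum G
    ≡⟨ sum-cong-≗ {n} (λ i → trans (sum-cong-≗ {n} (𝟙-adj≡isEdge+isEdge G i)) (∑-distrib-+ {n} _ _)) ⟩
  ∑[ i < n ] (∑[ j < n ] 𝟙 (isEdge G i j) + ∑[ j < n ] 𝟙 (isEdge G j i))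
    ≡⟨ ∑-distrib-+ {n} _ _ ⟩
  e + ∑[ i < n ] ∑[ j < n ] 𝟙 (isEdge G j i)
    ≡⟨ cong (e +_) (∑-comm {n} {n} λ i j → 𝟙 (isEdge G j i)) ⟩
  e + e
    ≡⟨ cong (λ x → x + x) (edgeCount≡∑isEdge G) ⟨
  edgeCount G + edgeCount G
    ≡⟨ cong (edgeCount G +_) (+-identityʳ (edgeCount G)) ⟨
  2 * edgeCount G ∎
  where
  open ≡-Reasoning
  e : ℕ
  e = ∑[ i < n ] ∑[ j < n ] 𝟙 (isEdge G i j)

-- Deleting a vertex

removeVertex : ∀ {m} → Fin (suc m) → Graph (suc m) → Graph m
removeVertex v G = record
  { adj    = λ i j → adj G (punchIn v i) (punchIn v j)
  ; sym    = λ i j → Graph.sym G (punchIn v i) (punchIn v j)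
  ; irrefl = λ i → Graph.irrefl G (punchIn v i)
  }

removeVertex-cliqueFree : ∀ {m a} (G : Graph (suc m)) v → CliqueFree a G → CliqueFree a (removeVertex v G)
removeVertex-cliqueFree G v noClique (f , f-injective , f-clique) =
  noClique (punchIn v ∘ f , f-injective ∘ Finₚ.punchIn-injective v _ _ , f-clique)

degree≡∑punchIn : ∀ {m} (G : Graph (suc m)) v → degree G v ≡ ∑[ j < m ] 𝟙 (adj G v (punchIn v j))
degree≡∑punchIn {m} G v = trans (sum-remove {m} {v} (𝟙 ∘ adj G v))
  (cong (λ b → 𝟙 b + ∑[ j < m ] 𝟙 (adj G v (punchIn v j))) (Graph.irrefl G v))

degree≤ : ∀ {m} (G : Graph (suc m)) v → degree G v ≤ m
degree≤ {m} G v = ≤-trans (≤-reflexive (degree≡∑punchIn G v)) (∑𝟙≤ m _)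

degreeSum-removeVertex : ∀ {m} (G : Graph (suc m)) v →
  degreeSum G ≡ degreeSum (removeVertex v G) + 2 * degree G v
degreeSum-removeVertex {m} G v = begin
  degreeSum G
    ≡⟨ sum-remove {m} {v} (degree G) ⟩
  d + ∑[ i < m ] degree G (punchIn v i)
    ≡⟨ cong (d +_) (sum-cong-≗ {m} λ i → sum-remove {m} {v} (𝟙 ∘ adj G (punchIn v i))) ⟩
  d + ∑[ i < m ] (𝟙 (adj G (punchIn v i) v) + ∑[ j < m ] 𝟙 (adj G (punchIn v i) (punchIn v j)))
    ≡⟨ cong (d +_) (∑-distrib-+ {m} _ _) ⟩
  d + (∑[ i < m ] 𝟙 (adj G (punchIn v i) v) + degreeSum (removeVertex v G))
    ≡⟨ cong (λ x → d + (x + degreeSum (removeVertex v G))) back-edges ⟩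
  d + (d + degreeSum (removeVertex v G))
    ≡⟨ rearrange d (degreeSum (removeVertex v G)) ⟩
  degreeSum (removeVertex v G) + 2 * d ∎
  where
  open ≡-Reasoning
  d : ℕ
  d = degree G v
  back-edges : ∑[ i < m ] 𝟙 (adj G (punchIn v i) v) ≡ d
  back-edges = trans (sum-cong-≗ {m} λ i → cong 𝟙 (Graph.sym G (punchIn v i) v)) (sym (degree≡∑punchIn G v))
  rearrange : ∀ x y → x + (x + y) ≡ y + 2 * x
  rearrange = solve-∀

edgeCount-removeVertex : ∀ {m} (G : Graph (suc m)) v →
  edgeCount G ≡ edgeCount (removeVertex v G) + degree G v
edgeCount-removeVertex G v = *-cancelˡ-≡ (edgeCount G) (edgeCount (removeVertex v G) + degree G v) 2 (begin
  2 * edgeCount G                                         ≡⟨ handshake G ⟨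
  degreeSum G                                             ≡⟨ degreeSum-removeVertex G v ⟩
  degreeSum (removeVertex v G) + 2 * degree G v           ≡⟨ cong (_+ 2 * degree G v) (handshake (removeVertex v G)) ⟩
  2 * edgeCount (removeVertex v G) + 2 * degree G v       ≡⟨ *-distribˡ-+ 2 (edgeCount (removeVertex v G)) (degree G v) ⟨
  2 * (edgeCount (removeVertex v G) + degree G v)         ∎)
  where open ≡-Reasoning

suc-C2 : ∀ m → suc m C 2 ≡ m + m C 2
suc-C2 m = trans (sym (nCk+nC[k+1]≡[n+1]C[k+1] m 1)) (cong (_+ m C 2) (nC1≡n m))

linked? : ∀ {n} (G : Graph n) i j → Dec (i ≡ j ⊎ adj G i j ≡ true)
linked? G i j = (i Finₚ.≟ j) ⊎-dec (adj G i j Bool.≟ true)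

missingEdge : ∀ {n} (G : Graph n) → ¬ HasClique n G → ∃₂ λ i j → i ≢ j × adj G i j ≡ false
missingEdge {n} G noClique with Finₚ.all? (λ i → Finₚ.all? (linked? G i))
... | yes complete = ⊥-elim (noClique (id , id , λ i j i≢j → [ ⊥-elim ∘ i≢j , id ] (complete i j)))
... | no ¬complete with Finₚ.¬∀⟶∃¬ n _ (λ i → Finₚ.all? (linked? G i)) ¬complete
...   | i , ¬linked-i with Finₚ.¬∀⟶∃¬ n _ (linked? G i) ¬linked-i
...     | j , ¬linked-ij = i , j , ¬linked-ij ∘ inj₁ , ¬-not (¬linked-ij ∘ inj₂)

degree<-nonNeighbour : ∀ {m} (G : Graph (suc m)) {v w} → v ≢ w → adj G v w ≡ false → degree G v < m
degree<-nonNeighbour {zero}  G {Fin.zero} {Fin.zero} v≢w _ = ⊥-elim (v≢w refl)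
degree<-nonNeighbour {suc m} G {v} {w} v≢w v≁w = begin-strict
  degree G v
    ≡⟨ degree≡∑punchIn G v ⟩
  ∑[ j < suc m ] 𝟙 (adj G v (punchIn v j))
    ≡⟨ sum-remove {m} {w′} (𝟙 ∘ adj G v ∘ punchIn v) ⟩
  𝟙 (adj G v (punchIn v w′)) + rest  ≡⟨ cong (λ x → 𝟙 (adj G v x) + rest) (Finₚ.punchIn-punchOut v≢w) ⟩
  𝟙 (adj G v w) + rest               ≡⟨ cong (λ b → 𝟙 b + rest) v≁w ⟩
  rest                               <⟨ s≤s (∑𝟙≤ m _) ⟩
  suc m ∎
  where
  open ≤-Reasoning
  w′ : Fin (suc m)
  w′ = punchOut v≢w
  rest : ℕ
  rest = ∑[ k < m ] 𝟙 (adj G v (punchIn v (punchIn w′ k)))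

edgeCount≤C2 : ∀ {n} (G : Graph n) → edgeCount G ≤ n C 2
edgeCount≤C2 {zero}  G = z≤n
edgeCount≤C2 {suc m} G = begin
  edgeCount G                                           ≡⟨ edgeCount-removeVertex G Fin.zero ⟩
  edgeCount (removeVertex Fin.zero G) + degree G Fin.zero ≤⟨ +-mono-≤ (edgeCount≤C2 (removeVertex Fin.zero G)) (degree≤ G Fin.zero) ⟩
  m C 2 + m                                             ≡⟨ +-comm (m C 2) m ⟩
  m + m C 2                                             ≡⟨ suc-C2 m ⟨
  suc m C 2                                             ∎
  where open ≤-Reasoning

cliqueFree⇒edgeCount≤C2∸1 : ∀ {n} (G : Graph n) → CliqueFree n G → edgeCount G ≤ n C 2 ∸ 1
cliqueFree⇒edgeCount≤C2∸1 {zero}  G noClique = ⊥-elim (noClique (id , id , λ ()))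
cliqueFree⇒edgeCount≤C2∸1 {suc m} G noClique with missingEdge G noClique
... | i , j , i≢j , i≁j = m+n≤o⇒m≤o∸n (edgeCount G) (begin
  edgeCount G + 1
    ≡⟨ +-comm (edgeCount G) 1 ⟩
  1 + edgeCount G
    ≡⟨ cong suc (edgeCount-removeVertex G i) ⟩
  1 + (edgeCount (removeVertex i G) + degree G i)
    ≡⟨ +-suc _ _ ⟨
  edgeCount (removeVertex i G) + suc (degree G i)
    ≤⟨ +-mono-≤ (edgeCount≤C2 (removeVertex i G)) (degree<-nonNeighbour G i≢j i≁j) ⟩
  m C 2 + m
    ≡⟨ trans (+-comm (m C 2) m) (sym (suc-C2 m)) ⟩
  suc m C 2 ∎)
  where open ≤-Reasoning

∑-edgeCount-removeVertex : ∀ {m} (G : Graph (suc m)) →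
  ∑[ v < suc m ] edgeCount (removeVertex v G) + 2 * edgeCount G ≡ suc m * edgeCount G
∑-edgeCount-removeVertex {m} G = begin
  ∑[ v < suc m ] edgeCount (removeVertex v G) + 2 * edgeCount G
    ≡⟨ cong (∑[ v < suc m ] edgeCount (removeVertex v G) +_) (handshake G) ⟨
  ∑[ v < suc m ] edgeCount (removeVertex v G) + degreeSum G
    ≡⟨ ∑-distrib-+ {suc m} (λ v → edgeCount (removeVertex v G)) (degree G) ⟨
  ∑[ v < suc m ] (edgeCount (removeVertex v G) + degree G v)
    ≡⟨ sum-cong-≗ {suc m} (sym ∘ edgeCount-removeVertex G) ⟩
  ∑[ v < suc m ] edgeCount G
    ≡⟨ ∑-const (suc m) (edgeCount G) ⟩
  suc m * edgeCount G ∎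
  where open ≡-Reasoning

edgeCount-averaging : ∀ {d} (G : Graph (suc (suc d))) B →
  (∀ v → edgeCount (removeVertex v G) ≤ B) → d * edgeCount G ≤ suc (suc d) * B
edgeCount-averaging {d} G B bound = +-cancelʳ-≤ (2 * e) (d * e) (suc (suc d) * B) (begin
  d * e + 2 * e                                           ≡⟨ *-distribʳ-+ e d 2 ⟨
  (d + 2) * e                                             ≡⟨ cong (_* e) (+-comm d 2) ⟩
  suc (suc d) * e                                         ≡⟨ ∑-edgeCount-removeVertex G ⟨
  ∑[ v < suc (suc d) ] edgeCount (removeVertex v G) + 2 * e
    ≤⟨ +-monoˡ-≤ (2 * e) (∑-mono-≤ (suc (suc d)) bound) ⟩
  ∑[ v < suc (suc d) ] B + 2 * e                          ≡⟨ cong (_+ 2 * e) (∑-const (suc (suc d)) B) ⟩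
  suc (suc d) * B + 2 * e                                 ∎)
  where
  open ≤-Reasoning
  e : ℕ
  e = edgeCount G

m*n≤o⇒m≤o/n : ∀ m n o .{{_ : NonZero n}} → m * n ≤ o → m ≤ o / n
m*n≤o⇒m≤o/n m n o m*n≤o = ≤-trans (≤-reflexive (sym (m*n/n≡m m n))) (/-monoˡ-≤ n m*n≤o)

cliqueFree⇒edgeCount≤tSeq : ∀ r-1 k {n} (G : Graph n) → n ≡ suc (suc r-1) + k →
  CliqueFree (suc (suc r-1)) G → edgeCount G ≤ tSeq (suc (suc r-1)) k
cliqueFree⇒edgeCount≤tSeq r-1 zero G n≡a+0 noClique
  with trans n≡a+0 (cong (suc ∘ suc) (+-identityʳ r-1))
... | refl = cliqueFree⇒edgeCount≤C2∸1 G noClique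
cliqueFree⇒edgeCount≤tSeq r-1 (suc k) G n≡a+1+k noClique
  with trans n≡a+1+k (cong (suc ∘ suc) (+-suc r-1 k))
... | refl = m*n≤o⇒m≤o/n (edgeCount G) (suc (r-1 + k)) _
  (≤-trans (≤-reflexive (*-comm (edgeCount G) (suc (r-1 + k))))
    (edgeCount-averaging G (tSeq (suc (suc r-1)) k) λ v →
      cliqueFree⇒edgeCount≤tSeq r-1 k (removeVertex v G) refl (removeVertex-cliqueFree G v noClique)))

-- Turán graphs

≡ᵇ-sym : ∀ x y → (x ≡ᵇ y) ≡ (y ≡ᵇ x)
≡ᵇ-sym zero    zero    = refl
≡ᵇ-sym zero    (suc y) = refl
≡ᵇ-sym (suc x) zero    = refl
≡ᵇ-sym (suc x) (suc y) = ≡ᵇ-sym x y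

≡ᵇ-refl : ∀ x → (x ≡ᵇ x) ≡ true
≡ᵇ-refl x = Equivalence.to T-≡ (≡⇒≡ᵇ x x refl)

𝟙-<ᵇ-suc : ∀ x s → 𝟙 (x <ᵇ s) + 𝟙 (x ≡ᵇ s) ≡ 𝟙 (x <ᵇ suc s)
𝟙-<ᵇ-suc zero    zero    = refl
𝟙-<ᵇ-suc zero    (suc s) = refl
𝟙-<ᵇ-suc (suc x) zero    = refl
𝟙-<ᵇ-suc (suc x) (suc s) = 𝟙-<ᵇ-suc x s

<ᵇ-irrefl : ∀ x → (x <ᵇ x) ≡ false
<ᵇ-irrefl zero    = refl
<ᵇ-irrefl (suc x) = <ᵇ-irrefl x

<⇒<ᵇ≡true : ∀ {x y} → x < y → (x <ᵇ y) ≡ true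
<⇒<ᵇ≡true = Equivalence.to T-≡ ∘ <⇒<ᵇ

colourGraph : (ℕ → ℕ) → ∀ n → Graph n
colourGraph c n = record
  { adj    = λ i j → not (c (toℕ i) ≡ᵇ c (toℕ j))
  ; sym    = λ i j → cong not (≡ᵇ-sym (c (toℕ i)) (c (toℕ j)))
  ; irrefl = λ i → cong not (≡ᵇ-refl (c (toℕ i)))
  }

sameColour⇒nonadjacent : ∀ (c : ℕ → ℕ) {n} {i j : Fin n} →
  c (toℕ i) ≡ c (toℕ j) → adj (colourGraph c n) i j ≡ false
sameColour⇒nonadjacent c {i = i} same = cong not
  (trans (cong (c (toℕ i) ≡ᵇ_) (sym same)) (≡ᵇ-refl (c (toℕ i))))

colourGraph-cliqueFree : ∀ {r} (c : ℕ → ℕ) → (∀ x → c x < r) → ∀ n → CliqueFree (suc r) (colourGraph c n)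
colourGraph-cliqueFree {r} c c<r n (f , _ , f-clique)
  with Finₚ.pigeonhole (n<1+n r) (λ i → fromℕ< (c<r (toℕ (f i))))
... | i , j , i<j , same-colour
  with trans (sym (f-clique i j (Finₚ.<⇒≢ i<j)))
             (sameColour⇒nonadjacent c (Finₚ.fromℕ<-injective _ _ (c<r (toℕ (f i))) (c<r (toℕ (f j))) same-colour))
... | ()

toℕ-punchIn-fromℕ : ∀ m (i : Fin m) → toℕ (punchIn (fromℕ m) i) ≡ toℕ i
toℕ-punchIn-fromℕ (suc m) Fin.zero    = refl
toℕ-punchIn-fromℕ (suc m) (Fin.suc i) = cong suc (toℕ-punchIn-fromℕ m i)

edgeCount-colourGraph-suc : ∀ c m → edgeCount (colourGraph c (suc m)) ≡
  edgeCount (colourGraph c m) + ∑[ j < m ] 𝟙 (not (c m ≡ᵇ c (toℕ j)))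
edgeCount-colourGraph-suc c m = begin
  edgeCount G
    ≡⟨ edgeCount-removeVertex G (fromℕ m) ⟩
  edgeCount (removeVertex (fromℕ m) G) + degree G (fromℕ m)
    ≡⟨ cong₂ _+_ (edgeCount-cong {G = removeVertex (fromℕ m) G} {H = colourGraph c m} λ i j →
                   cong₂ (λ x y → not (c x ≡ᵇ c y)) (toℕ-punchIn-fromℕ m i) (toℕ-punchIn-fromℕ m j))
                 (trans (degree≡∑punchIn G (fromℕ m)) (sum-cong-≗ {m} λ j →
                   cong₂ (λ x y → 𝟙 (not (c x ≡ᵇ c y))) (Finₚ.toℕ-fromℕ m) (toℕ-punchIn-fromℕ m j))) ⟩
  edgeCount (colourGraph c m) + ∑[ j < m ] 𝟙 (not (c m ≡ᵇ c (toℕ j))) ∎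
  where
  open ≡-Reasoning
  G : Graph (suc m)
  G = colourGraph c (suc m)

∑𝟙-not : ∀ m (p : Fin m → Bool) → ∑[ j < m ] 𝟙 (not (p j)) ≡ m ∸ ∑[ j < m ] 𝟙 (p j)
∑𝟙-not m p = sym (trans (cong (_∸ ∑[ j < m ] 𝟙 (p j)) (sym total))
                        (m+n∸n≡m (∑[ j < m ] 𝟙 (not (p j))) (∑[ j < m ] 𝟙 (p j))))
  where
  total : ∑[ j < m ] 𝟙 (not (p j)) + ∑[ j < m ] 𝟙 (p j) ≡ m
  total = trans (sym (∑-distrib-+ {m} _ _)) (trans (sum-cong-≗ {m} (𝟙-not ∘ p)) (trans (∑-const m 1) (*-identityʳ m)))

[s+q*n]/n≡q : ∀ {n} .{{_ : NonZero n}} s q → s < n → (s + q * n) / n ≡ q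
[s+q*n]/n≡q {n} s q s<n = begin
  (s + q * n) / n       ≡⟨ +-distrib-/-∣ʳ s (divides-refl q) ⟩
  s / n + (q * n) / n   ≡⟨ cong₂ _+_ (m<n⇒m/n≡0 s<n) (m*n/n≡m q n) ⟩
  q                     ∎
  where open ≡-Reasoning

[s+q*n]%n≡s : ∀ {n} .{{_ : NonZero n}} s q → s < n → (s + q * n) % n ≡ s
[s+q*n]%n≡s {n} s q s<n = trans ([m+kn]%n≡m%n s q n) (m<n⇒m%n≡m s<n)

/-%-suc : ∀ {r} .{{_ : NonZero r}} m →
  (suc (m % r) < r × suc m / r ≡ m / r × suc m % r ≡ suc (m % r)) ⊎
  (suc (m % r) ≡ r × suc m / r ≡ suc (m / r) × suc m % r ≡ 0)
/-%-suc {r} m with suc (m % r) <? r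
... | yes s+1<r = inj₁ (s+1<r ,
  trans (cong (_/ r) suc-m) ([s+q*n]/n≡q (suc (m % r)) (m / r) s+1<r) ,
  trans (cong (_% r) suc-m) ([s+q*n]%n≡s (suc (m % r)) (m / r) s+1<r))
  where
  suc-m : suc m ≡ suc (m % r) + (m / r) * r
  suc-m = cong suc (m≡m%n+[m/n]*n m r)
... | no s+1≮r = inj₂ (s+1≡r ,
  trans (cong (_/ r) suc-m) ([s+q*n]/n≡q 0 (suc (m / r)) (>-nonZero⁻¹ r)) ,
  trans (cong (_% r) suc-m) ([s+q*n]%n≡s 0 (suc (m / r)) (>-nonZero⁻¹ r)))
  where
  s+1≡r : suc (m % r) ≡ r
  s+1≡r = ≤-antisym (m%n<n m r) (≮⇒≥ s+1≮r)
  suc-m : suc m ≡ suc (m / r) * r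
  suc-m = begin
    suc m                          ≡⟨ cong suc (m≡m%n+[m/n]*n m r) ⟩
    suc (m % r) + (m / r) * r      ≡⟨ cong (_+ (m / r) * r) s+1≡r ⟩
    suc (m / r) * r                ∎
    where open ≡-Reasoning

-- (r ∸ s) q² + s (q + 1)²: the sum of the squared class sizes when q r + s vertices (s < r)
-- are split into r classes as equally as possible.
partSquares : ℕ → ℕ → ℕ → ℕ
partSquares r q s = r * (q * q) + 2 * (s * q) + s

2≤q*[1+s]+s : ∀ q s u → suc (suc (s + u)) ≤ q * suc (s + u) + s → 2 ≤ q * suc s + s
2≤q*[1+s]+s zero          s       u big = ⊥-elim (≤⇒≯ big (s≤s (m≤n⇒m≤1+n (m≤m+n s u))))
2≤q*[1+s]+s (suc zero)    zero    u big =
  ⊥-elim (≤⇒≯ big (s≤s (≤-reflexive (trans (+-identityʳ (1 * suc u)) (*-identityˡ (suc u))))))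
2≤q*[1+s]+s (suc zero)    (suc s) u big = s≤s (s≤s z≤n)
2≤q*[1+s]+s (suc (suc q)) s       u big =
  ≤-trans (*-mono-≤ (s≤s (s≤s (z≤n {q}))) (s≤s (z≤n {s}))) (m≤m+n (suc (suc q) * suc s) s)

q*u<n∸1 : ∀ q s u k → suc (suc (s + u)) ≤ suc (suc k) → suc (suc k) ≡ q * suc (s + u) + s → q * u < suc k
q*u<n∸1 q s u k big n≡qr+s = s≤s (+-cancelˡ-≤ 2 (q * u) k (begin
  2 + q * u                 ≡⟨ +-comm 2 (q * u) ⟩
  q * u + 2                 ≤⟨ +-monoʳ-≤ (q * u) (2≤q*[1+s]+s q s u (≤-trans big (≤-reflexive n≡qr+s))) ⟩
  q * u + (q * suc s + s)   ≡⟨ regroup q s u ⟩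
  q * suc (s + u) + s       ≡⟨ n≡qr+s ⟨
  2 + k                     ∎))
  where
  open ≤-Reasoning
  regroup : ∀ q s u → q * u + (q * suc s + s) ≡ q * suc (s + u) + s
  regroup = solve-∀

-- From 2E + partSquares = n² one gets 2E = (n − 1)(n − q) + q (r − 1 − s), and the remainder
-- q (r − 1 − s) is below n − 1 once n > r.
turán-floor-step : ∀ r-1 q s k E → s ≤ r-1 → suc (suc k) ≡ q * suc r-1 + s → suc (suc r-1) ≤ suc (suc k) →
  2 * E + partSquares (suc r-1) q s ≡ suc (suc k) * suc (suc k) →
  (suc (suc (suc k)) * E) / suc k ≡ E + (suc (suc k) ∸ q)
turán-floor-step r-1 q s k E s≤r-1 n≡qr+s big twiceE+ps≡n² with m≤n⇒∃[o]m+o≡n s≤r-1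
... | u , refl = begin
  (suc (suc (suc k)) * E) / suc k   ≡⟨ cong (_/ suc k) scaled ⟩
  (q * u + (E + D) * suc k) / suc k ≡⟨ [s+q*n]/n≡q (q * u) (E + D) (q*u<n∸1 q s u k big n≡qr+s) ⟩
  E + D                             ≡⟨ cong (E +_) n∸q≡D ⟨
  E + (suc (suc k) ∸ q)             ∎
  where
  open ≡-Reasoning
  N D PS : ℕ
  N = suc (suc k)
  D = q * (s + u) + s
  PS = partSquares (suc (s + u)) q s
  n∸q≡D : N ∸ q ≡ D
  n∸q≡D = begin
    N ∸ q                              ≡⟨ cong (_∸ q) n≡qr+s ⟩
    q * suc (s + u) + s ∸ q            ≡⟨ cong (λ x → x + s ∸ q) (*-suc q (s + u)) ⟩
    q + q * (s + u) + s ∸ q            ≡⟨ cong (_∸ q) (+-assoc q (q * (s + u)) s) ⟩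
    q + (q * (s + u) + s) ∸ q          ≡⟨ m+n∸m≡n q D ⟩
    D                                  ∎
  square : D * N + q * u + PS ≡ N * N + D
  square = subst (λ x → D * x + q * u + PS ≡ x * x + D) (sym n≡qr+s) (identity q s u)
    where
    identity : ∀ q s u → (q * (s + u) + s) * (q * suc (s + u) + s) + q * u +
                 (suc (s + u) * (q * q) + 2 * (s * q) + s)
               ≡ (q * suc (s + u) + s) * (q * suc (s + u) + s) + (q * (s + u) + s)
    identity = solve-∀
  twiceE : 2 * E ≡ D * suc k + q * u
  twiceE = +-cancelʳ-≡ (PS + D) (2 * E) (D * suc k + q * u) (begin
    2 * E + (PS + D)              ≡⟨ +-assoc (2 * E) PS D ⟨
    2 * E + PS + D                ≡⟨ cong (_+ D) twiceE+ps≡n² ⟩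
    N * N + D                     ≡⟨ square ⟨
    D * N + q * u + PS            ≡⟨ regroup D k (q * u) PS ⟩
    D * suc k + q * u + (PS + D)  ∎)
    where
    regroup : ∀ D k qu PS → D * suc (suc k) + qu + PS ≡ D * suc k + qu + (PS + D)
    regroup = solve-∀
  scaled : suc (suc (suc k)) * E ≡ q * u + (E + D) * suc k
  scaled = begin
    suc (suc (suc k)) * E          ≡⟨ split k E ⟩
    suc k * E + 2 * E              ≡⟨ cong (suc k * E +_) twiceE ⟩
    suc k * E + (D * suc k + q * u) ≡⟨ regroup k E D (q * u) ⟩
    q * u + (E + D) * suc k        ∎
    where
    split : ∀ k E → suc (suc (suc k)) * E ≡ suc k * E + 2 * E
    split = solve-∀
    regroup : ∀ k E D qu → suc k * E + (D * suc k + qu) ≡ qu + (E + D) * suc k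
    regroup = solve-∀

module TuránGraph (r-1 : ℕ) where

  r : ℕ
  r = suc r-1

  turánGraph : ∀ n → Graph n
  turánGraph = colourGraph (_% r)

  turánGraph-cliqueFree : ∀ n → CliqueFree (suc r) (turánGraph n)
  turánGraph-cliqueFree = colourGraph-cliqueFree (_% r) (λ x → m%n<n x r)

  colourClassSize-suc : ∀ m {x} → x < r → m / r + 𝟙 (x <ᵇ suc (m % r)) ≡ suc m / r + 𝟙 (x <ᵇ suc m % r)
  colourClassSize-suc m {x} x<r with /-%-suc {r} m
  ... | inj₁ (_ , q′≡q , s′≡s+1) = cong₂ (λ q s → q + 𝟙 (x <ᵇ s)) (sym q′≡q) (sym s′≡s+1)
  ... | inj₂ (s+1≡r , q′≡q+1 , s′≡0) = begin
    m / r + 𝟙 (x <ᵇ suc (m % r))  ≡⟨ cong (λ s → m / r + 𝟙 (x <ᵇ s)) s+1≡r ⟩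
    m / r + 𝟙 (x <ᵇ r)            ≡⟨ cong (λ b → m / r + 𝟙 b) (<⇒<ᵇ≡true x<r) ⟩
    m / r + 1                     ≡⟨ trans (+-comm (m / r) 1) (sym (+-identityʳ (suc (m / r)))) ⟩
    suc (m / r) + 0               ≡⟨ cong₂ (λ q s → q + 𝟙 (x <ᵇ s)) (sym q′≡q+1) (sym s′≡0) ⟩
    suc m / r + 𝟙 (x <ᵇ suc m % r) ∎
    where open ≡-Reasoning

  colourClassSize : ∀ m {x} → x < r → ∑[ j < m ] 𝟙 (x ≡ᵇ toℕ j % r) ≡ m / r + 𝟙 (x <ᵇ m % r)
  colourClassSize zero    x<r = refl
  colourClassSize (suc m) {x} x<r = begin
    ∑[ j < suc m ] 𝟙 (x ≡ᵇ toℕ j % r)              ≡⟨ ∑-toℕ-last m (λ j → 𝟙 (x ≡ᵇ j % r)) ⟩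
    ∑[ j < m ] 𝟙 (x ≡ᵇ toℕ j % r) + 𝟙 (x ≡ᵇ m % r)  ≡⟨ cong (_+ 𝟙 (x ≡ᵇ m % r)) (colourClassSize m x<r) ⟩
    m / r + 𝟙 (x <ᵇ m % r) + 𝟙 (x ≡ᵇ m % r)        ≡⟨ +-assoc (m / r) _ _ ⟩
    m / r + (𝟙 (x <ᵇ m % r) + 𝟙 (x ≡ᵇ m % r))      ≡⟨ cong (m / r +_) (𝟙-<ᵇ-suc x (m % r)) ⟩
    m / r + 𝟙 (x <ᵇ suc (m % r))                   ≡⟨ colourClassSize-suc m x<r ⟩
    suc m / r + 𝟙 (x <ᵇ suc m % r)                 ∎
    where open ≡-Reasoning

  -- Vertex m is joined to all earlier vertices except the m / r of its own colour.
  turánEdges : ℕ → ℕ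
  turánEdges zero    = 0
  turánEdges (suc m) = turánEdges m + (m ∸ m / r)

  edgeCount-turánGraph : ∀ n → edgeCount (turánGraph n) ≡ turánEdges n
  edgeCount-turánGraph zero    = refl
  edgeCount-turánGraph (suc m) = begin
    edgeCount (turánGraph (suc m))
      ≡⟨ edgeCount-colourGraph-suc (_% r) m ⟩
    edgeCount (turánGraph m) + ∑[ j < m ] 𝟙 (not (m % r ≡ᵇ toℕ j % r))
      ≡⟨ cong₂ _+_ (edgeCount-turánGraph m) (∑𝟙-not m (λ j → m % r ≡ᵇ toℕ j % r)) ⟩
    turánEdges m + (m ∸ ∑[ j < m ] 𝟙 (m % r ≡ᵇ toℕ j % r))
      ≡⟨ cong (λ x → turánEdges m + (m ∸ x)) (colourClassSize m (m%n<n m r)) ⟩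
    turánEdges m + (m ∸ (m / r + 𝟙 (m % r <ᵇ m % r)))
      ≡⟨ cong (λ b → turánEdges m + (m ∸ (m / r + 𝟙 b))) (<ᵇ-irrefl (m % r)) ⟩
    turánEdges m + (m ∸ (m / r + 0))
      ≡⟨ cong (λ x → turánEdges m + (m ∸ x)) (+-identityʳ (m / r)) ⟩
    turánEdges (suc m) ∎
    where open ≡-Reasoning

  partSquares-suc : ∀ m → partSquares r (suc m / r) (suc m % r) ≡ partSquares r (m / r) (m % r) + 2 * (m / r) + 1
  partSquares-suc m with /-%-suc {r} m
  ... | inj₁ (_ , q′≡q , s′≡s+1) rewrite q′≡q | s′≡s+1 = within r (m / r) (m % r)
    where
    within : ∀ r q s → r * (q * q) + 2 * (suc s * q) + suc s ≡ r * (q * q) + 2 * (s * q) + s + 2 * q + 1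
    within = solve-∀
  ... | inj₂ (s+1≡r , q′≡q+1 , s′≡0) rewrite q′≡q+1 | s′≡0 | suc-injective s+1≡r = carry r-1 (m / r)
    where
    carry : ∀ r-1 q → suc r-1 * (suc q * suc q) + 2 * (0 * suc q) + 0 ≡
                      suc r-1 * (q * q) + 2 * (r-1 * q) + r-1 + 2 * q + 1
    carry = solve-∀

  twice-turánEdges : ∀ n → 2 * turánEdges n + partSquares r (n / r) (n % r) ≡ n * n
  twice-turánEdges zero    = cong (λ x → x + 0 + 0) (*-zeroʳ r)
  twice-turánEdges (suc n) = begin
    2 * (E + (n ∸ q)) + partSquares r (suc n / r) (suc n % r)
      ≡⟨ cong (2 * (E + (n ∸ q)) +_) (partSquares-suc n) ⟩
    2 * (E + (n ∸ q)) + (partSquares r q (n % r) + 2 * q + 1)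
      ≡⟨ regroup E (n ∸ q) (partSquares r q (n % r)) q ⟩
    (2 * E + partSquares r q (n % r)) + 2 * ((n ∸ q) + q) + 1
      ≡⟨ cong₂ (λ x y → x + 2 * y + 1) (twice-turánEdges n) (m∸n+n≡m (m/n≤m n r)) ⟩
    n * n + 2 * n + 1
      ≡⟨ square-suc n ⟩
    suc n * suc n ∎
    where
    open ≡-Reasoning
    E q : ℕ
    E = turánEdges n
    q = n / r
    regroup : ∀ E D PS q → 2 * (E + D) + (PS + 2 * q + 1) ≡ (2 * E + PS) + 2 * (D + q) + 1
    regroup = solve-∀
    square-suc : ∀ n → n * n + 2 * n + 1 ≡ suc n * suc n
    square-suc = solve-∀

  turánEdges-complete : ∀ n → n ≤ r → turánEdges n ≡ n C 2
  turánEdges-complete zero    _   = refl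
  turánEdges-complete (suc m) m<r = begin
    turánEdges m + (m ∸ m / r)  ≡⟨ cong₂ (λ e q → e + (m ∸ q)) (turánEdges-complete m (<⇒≤ m<r)) (m<n⇒m/n≡0 m<r) ⟩
    m C 2 + m                   ≡⟨ +-comm (m C 2) m ⟩
    m + m C 2                   ≡⟨ suc-C2 m ⟨
    suc m C 2                   ∎
    where open ≡-Reasoning

  turánEdges-base : turánEdges (suc r) ≡ suc r C 2 ∸ 1
  turánEdges-base = begin
    turánEdges r + (r ∸ r / r)  ≡⟨ cong₂ (λ e q → e + (r ∸ q)) (turánEdges-complete r ≤-refl) (n/n≡1 r) ⟩
    r C 2 + r-1                 ≡⟨ +-comm (r C 2) r-1 ⟩
    r-1 + r C 2                 ≡⟨ cong (_∸ 1) (suc-C2 r) ⟨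
    suc r C 2 ∸ 1               ∎
    where open ≡-Reasoning

  turánEdges-step : ∀ k → suc r ≤ suc (suc k) →
    (suc (suc (suc k)) * turánEdges (suc (suc k))) / suc k ≡ turánEdges (suc (suc (suc k)))
  turánEdges-step k big = turán-floor-step r-1 (n / r) (n % r) k (turánEdges n)
    (s≤s⁻¹ (m%n<n n r)) (trans (m≡m%n+[m/n]*n n r) (+-comm (n % r) _)) big (twice-turánEdges n)
    where
    n : ℕ
    n = suc (suc k)

  turánEdges≡tSeq : ∀ k → turánEdges (suc r + k) ≡ tSeq (suc r) k
  turánEdges≡tSeq zero    = trans (cong turánEdges (+-identityʳ (suc r))) turánEdges-base
  turánEdges≡tSeq (suc k) = begin
    turánEdges (suc r + suc k)                                   ≡⟨ cong turánEdges (+-suc (suc r) k) ⟩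
    turánEdges (suc (suc r + k))                                 ≡⟨ turánEdges-step (r-1 + k) (s≤s (s≤s (m≤m+n r-1 k))) ⟨
    (suc (suc r + k) * turánEdges (suc r + k)) / suc (r-1 + k)   ≡⟨ cong (λ e → (suc (suc r + k) * e) / suc (r-1 + k)) (turánEdges≡tSeq k) ⟩
    tSeq (suc r) (suc k)                                         ∎
    where open ≡-Reasoning

turán-isEx : ∀ r-1 n → suc (suc r-1) ≤ n → IsEx n (suc (suc r-1)) (t (suc (suc r-1)) n)
turán-isEx r-1 n a≤n =
  (turánGraph n , turánGraph-cliqueFree n ,
    trans (edgeCount-turánGraph n) (trans (cong turánEdges n≡a+k) (turánEdges≡tSeq k))) ,
  λ G noClique → cliqueFree⇒edgeCount≤tSeq r-1 k G n≡a+k noClique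
  where
  open TuránGraph r-1
  k : ℕ
  k = n ∸ suc r
  n≡a+k : n ≡ suc r + k
  n≡a+k = sym (m+[n∸m]≡n a≤n)

mainTheorem1 : ∀ (a n : ℕ) → 3 ≤ a → a ≤ n → IsEx n a (t a n)
mainTheorem1 (suc (suc r-1)) n _         a≤n = turán-isEx r-1 n a≤n
mainTheorem1 (suc zero)      n (s≤s ()) _
mainTheorem1 zero            n ()        _
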